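{- For every integer $k\ge 2$, $f(2^{2^k-1},3) \ge 2^{k}$.
   Context: For a finite sequence of positive integers $(a_1,\dots,a_n)$, its continuant $\langle a_1,\dots,a_n\rangle$ is the denominator of the continued fraction $[0;a_1,\dots,a_n]$; equivalently $\langle\,\rangle=1$, $\langle a_1\rangle=a_1$, and $\langle a_1,\dots,a_n\rangle=a_n\langle a_1,\dots,a_{n-1}\rangle+\langle a_1,\dots,a_{n-2}\rangle$. For positive integers $D$ and $N$, $f(D,N)$ denotes the number of finite sequences $(a_1,\dots,a_n)$ of positive integers, of arbitrary length $n\ge 1$, with $a_i<N$ for all $i$ and $\langle a_1,\dots,a_n\rangle=D$. -}

module Defs where

open import Data.Nat using (ℕ; zero; suc; _+_; _*_; _<_; _<ᵇ_)
open import Data.List using (List; []; _∷_; _++_; map; concatMap; length; filter; upTo; allFin)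
open import Data.Bool using (Bool; true; false; _∧_)
open import Relation.Nullary.Decidable using (_because_)
open import Relation.Binary.PropositionalEquality using (_≡_)
import Data.Nat as Nat

-- Continuant ⟨a₁,…,aₙ⟩ via the recurrence
--   ⟨⟩ = 1, ⟨a₁⟩ = a₁, ⟨a₁,…,aₙ⟩ = aₙ⟨a₁,…,aₙ₋₁⟩ + ⟨a₁,…,aₙ₋₂⟩.
-- We process the list from left to right carrying the pair
-- (⟨a₁..aₘ₋₁⟩, ⟨a₁..aₘ⟩), starting with (⟨⟩₋₁ , ⟨⟩) = (0 , 1);
-- indeed 0 is the conventional value making ⟨a₁⟩ = a₁·1 + 0.
continuantAux : ℕ → ℕ → List ℕ → ℕ
continuantAux p q []       = q
continuantAux p q (a ∷ as) = continuantAux q (a * q + p) as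

continuant : List ℕ → ℕ
continuant = continuantAux 0 1

seqsOfLength : ℕ → ℕ → List (List ℕ)
seqsOfLength N zero    = [] ∷ []
seqsOfLength N (suc n) =
  concatMap (λ a → map (a ∷_) (seqsOfLength N n)) (map suc (upTo (N Nat.∸ 1)))

seqsUpTo : ℕ → ℕ → List (List ℕ)
seqsUpTo N D = concatMap (λ n → seqsOfLength N (suc n)) (upTo D)

-- f(D,N): number of finite sequences (a₁,…,aₙ), n ≥ 1, of positive
-- integers with aᵢ < N and ⟨a₁,…,aₙ⟩ = D.
-- Any such sequence has length n ≤ D (a sequence of positive integers of
-- length n has continuant ≥ F_{n+1} ≥ n), so enumerating lengths 1 … D
-- enumerates all of them.
f : ℕ → ℕ → ℕ
f D N = length (filter (λ s → continuant s Nat.≟ D) (seqsUpTo N D))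

module Submission where

-- For k = n + 2 we exhibit 2^k distinct words over {1,2} with continuant
-- 2^(2^k - 1) and find them inside the enumeration that defines f.
--
-- A state (p, q) holds two consecutive continuants; appending a letter a acts
-- by the matrix (p, q) ↦ (q, aq + p), which is symmetric for the pairing
-- (p,q)·(c,d) = pc + qd.  Hence running reverse M on one side of the pairing is
-- running M on the other side (`run-reverse`).  Both end blocks "1 1" and "2"
-- lead to the state ρ = (1,2), so edge ++ M ++ edge has continuant
-- run ρ M · ρ, the framed value of M.  For the hinges 1112 and 2111 the mirror
-- word M ++ hinge ++ reverse M has framed value 2v² when M has framed value v
-- (`framedValue-mirror`).  From M = 1 (value 8 = 2^(2^2-1)), n mirror steps with
-- free hinges give 2^n words of value 2^(2^(n+2)-1); free end blocks multiply
-- this by 4.  All construction steps are injective, so the words are distinct,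
-- and every word lies in the enumeration since its length is at most its
-- continuant.

open import Defs
open import Data.Nat using (ℕ; zero; suc; _+_; _*_; _≤_; _^_; _∸_; s≤s; z≤n; _≟_)
open import Data.Nat.Properties
  using (*-comm; *-assoc; *-identityˡ; *-identityʳ; +-comm; +-suc; +-identityʳ; ^-distribˡ-+-*; m^n>0;
         ≤-refl; ≤-reflexive; ≤-trans; +-mono-≤; +-monoˡ-≤; *-monoˡ-≤; m≤n⇒m≤n+o;
         suc-injective; +-cancelˡ-≡; *-cancelˡ-≡; module ≤-Reasoning)
open import Data.Nat.Tactic.RingSolver using (solve-∀)
open import Data.Bool using (Bool; true; false)
open import Data.Product using (_×_; _,_; proj₁; proj₂)
open import Data.List
  using (List; []; _∷_; _++_; [_]; map; length; filter; upTo; foldl; reverse; cartesianProductWith; cartesianProduct)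
open import Data.List.Properties
  using (foldl-++; foldl-∷ʳ; unfold-reverse; reverse-++; reverse-injective; length-++; length-map; length-reverse; length-++-sucʳ; ∷-injective)
open import Data.List.Relation.Unary.All as All using (All; []; _∷_)
open import Data.List.Relation.Unary.All.Properties using (++⁺)
open import Data.List.Relation.Unary.Any as Any using (here; there)
open import Data.List.Relation.Unary.Any.Properties using (reverse⁻)
open import Data.List.Relation.Unary.AllPairs using ([]; _∷_)
open import Data.List.Relation.Unary.Unique.Propositional using (Unique)
open import Data.List.Relation.Unary.Unique.Propositional.Properties using (cartesianProductWith⁺; cartesianProduct⁺)
open import Data.List.Membership.Propositional using (_∈_)
open import Data.List.Membership.Propositional.Properties
  using (∈-∃++; ∈-++⁻; ∈-++⁺ˡ; ∈-++⁺ʳ; ∈-map⁺; ∈-map⁻; ∈-concatMap⁺; ∈-upTo⁺; ∈-filter⁺; ∈-cartesianProductWith⁻)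
open import Data.Empty using (⊥-elim)
open import Data.Sum using (inj₁; inj₂)
open import Relation.Binary.PropositionalEquality
  using (_≡_; refl; sym; trans; cong; cong₂; subst; module ≡-Reasoning)

State : Set
State = ℕ × ℕ

step : State → ℕ → State
step (p , q) a = q , a * q + p

run : State → List ℕ → State
run = foldl step

continuantAux-run : ∀ p q xs → continuantAux p q xs ≡ proj₂ (run (p , q) xs)
continuantAux-run p q []       = refl
continuantAux-run p q (a ∷ xs) = continuantAux-run q (a * q + p) xs

infix 5 _·_
_·_ : State → State → ℕ
(a , b) · (c , d) = a * c + b * d

·-comm : ∀ u v → u · v ≡ v · u
·-comm (a , b) (c , d) = cong₂ _+_ (*-comm a c) (*-comm b d)

step-symmetric : ∀ u a v → step u a · v ≡ u · step v a
step-symmetric (p , q) a (c , d) = lemma p q a c d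
  where
  lemma : ∀ p q a c d → q * c + (a * q + p) * d ≡ p * d + q * (a * d + c)
  lemma = solve-∀

-- Transposition: the product of the step matrices of reverse xs is the
-- transpose of that of xs.
run-reverse : ∀ u xs v → run u (reverse xs) · v ≡ run v xs · u
run-reverse u []       v = ·-comm u v
run-reverse u (a ∷ xs) v = begin
  run u (reverse (a ∷ xs)) · v   ≡⟨ cong (λ w → run u w · v) (unfold-reverse a xs) ⟩
  run u (reverse xs ++ [ a ]) · v ≡⟨ cong (_· v) (foldl-∷ʳ step u a (reverse xs)) ⟩
  step (run u (reverse xs)) a · v ≡⟨ step-symmetric (run u (reverse xs)) a v ⟩
  run u (reverse xs) · step v a   ≡⟨ run-reverse u xs (step v a) ⟩
  run v (a ∷ xs) · u              ∎
  where open ≡-Reasoning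

Letter : ℕ → ℕ → Set
Letter N a = a ∈ map suc (upTo (N ∸ 1))

letter-positive : ∀ {N a} → Letter N a → 1 ≤ a
letter-positive {N} a∈ with ∈-map⁻ suc {xs = upTo (N ∸ 1)} a∈
... | _ , _ , refl = s≤s z≤n

record Solution (N D : ℕ) (w : List ℕ) : Set where
  field
    nonempty : 1 ≤ length w
    letters  : All (Letter N) w
    value    : continuant w ≡ D

-- With positive letters each step raises the continuant by at least one.
length≤continuantAux : ∀ {p q} xs → 1 ≤ p → 1 ≤ q → All (1 ≤_) xs → q + length xs ≤ continuantAux p q xs
length≤continuantAux []       _   _   []         = ≤-reflexive (+-identityʳ _)
length≤continuantAux {p} {q} (a ∷ xs) 1≤p 1≤q (1≤a ∷ ps) = begin
  q + suc (length xs)             ≡⟨ +-suc q (length xs) ⟩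
  suc q + length xs               ≤⟨ +-monoˡ-≤ (length xs) grows ⟩
  (a * q + p) + length xs         ≤⟨ length≤continuantAux xs 1≤q 1≤q′ ps ⟩
  continuantAux q (a * q + p) xs  ∎
  where
  open ≤-Reasoning
  q≤aq : q ≤ a * q
  q≤aq = ≤-trans (≤-reflexive (sym (*-identityˡ q))) (*-monoˡ-≤ q 1≤a)
  grows : suc q ≤ a * q + p
  grows = ≤-trans (≤-reflexive (+-comm 1 q)) (+-mono-≤ q≤aq 1≤p)
  1≤q′ : 1 ≤ a * q + p
  1≤q′ = ≤-trans 1≤q (m≤n⇒m≤n+o p q≤aq)

length≤continuant : ∀ xs → All (1 ≤_) xs → length xs ≤ continuant xs
length≤continuant []       []         = z≤n
length≤continuant (a ∷ xs) (1≤a ∷ ps) = begin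
  suc (length xs)              ≤⟨ +-monoˡ-≤ (length xs) 1≤a′ ⟩
  (a * 1 + 0) + length xs      ≤⟨ length≤continuantAux xs ≤-refl 1≤a′ ps ⟩
  continuant (a ∷ xs)          ∎
  where
  open ≤-Reasoning
  1≤a′ : 1 ≤ a * 1 + 0
  1≤a′ = subst (1 ≤_) (sym (trans (+-identityʳ (a * 1)) (*-identityʳ a))) 1≤a

seqsOfLength-complete : ∀ {N} xs → All (Letter N) xs → xs ∈ seqsOfLength N (length xs)
seqsOfLength-complete         []       []         = here refl
seqsOfLength-complete {N} (a ∷ xs) (a∈ ∷ ps) =
  ∈-concatMap⁺ (λ b → map (b ∷_) (seqsOfLength N (length xs))) (Any.map (λ { refl → ∈-map⁺ (a ∷_) (seqsOfLength-complete {N} xs ps) }) a∈)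

seqsUpTo-complete : ∀ {N D} xs → All (Letter N) xs → 1 ≤ length xs → length xs ≤ D → xs ∈ seqsUpTo N D
seqsUpTo-complete {N} (a ∷ xs) ps _ len≤D =
  ∈-concatMap⁺ (λ n → seqsOfLength N (suc n)) (Any.map (λ { refl → seqsOfLength-complete {N} (a ∷ xs) ps }) (∈-upTo⁺ len≤D))

solution-enumerated : ∀ {N D w} → Solution N D w → w ∈ filter (λ s → continuant s ≟ D) (seqsUpTo N D)
solution-enumerated {N} {D} {w} sol = ∈-filter⁺ (λ s → continuant s ≟ D) (seqsUpTo-complete {N} w letters nonempty w≤D) value
  where
  open Solution sol
  w≤D : length w ≤ D
  w≤D = subst (length w ≤_) value (length≤continuant w (All.map (letter-positive {N}) letters))

unique-length-≤ : ∀ {A : Set} (xs ys : List A) → Unique xs → (∀ {x} → x ∈ xs → x ∈ ys) → length xs ≤ length ys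
unique-length-≤ []       ys _            _   = z≤n
unique-length-≤ (x ∷ xs) ys (x∉xs ∷ uxs) xs⊆ys with ∈-∃++ (xs⊆ys (here refl))
... | as , bs , refl = begin
  suc (length xs)        ≤⟨ s≤s (unique-length-≤ xs (as ++ bs) uxs xs⊆as++bs) ⟩
  suc (length (as ++ bs)) ≡⟨ length-++-sucʳ as x bs ⟨
  length (as ++ x ∷ bs)   ∎
  where
  open ≤-Reasoning
  -- Every element of xs differs from x, so it survives removing x from ys.
  xs⊆as++bs : ∀ {y} → y ∈ xs → y ∈ as ++ bs
  xs⊆as++bs y∈ with ∈-++⁻ as (xs⊆ys (there y∈))
  ... | inj₁ y∈as          = ∈-++⁺ˡ y∈as
  ... | inj₂ (here y≡x)    = ⊥-elim (All.lookup x∉xs y∈ (sym y≡x))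
  ... | inj₂ (there y∈bs)  = ∈-++⁺ʳ as y∈bs

f-lower-bound : ∀ {N D} ws → Unique ws → (∀ {w} → w ∈ ws → Solution N D w) → length ws ≤ f D N
f-lower-bound {N} {D} ws uniq sound = unique-length-≤ ws _ uniq (λ w∈ → solution-enumerated (sound w∈))

all-reverse : ∀ {A : Set} {P : A → Set} {xs} → All P xs → All P (reverse xs)
all-reverse ps = All.tabulate (λ x∈ → All.lookup ps (reverse⁻ x∈))

++-cancel-equal-length : ∀ {A : Set} (xs ys : List A) {us vs : List A} →
                         length xs ≡ length ys → xs ++ us ≡ ys ++ vs → xs ≡ ys × us ≡ vs
++-cancel-equal-length []       []       _   eq = refl , eq
++-cancel-equal-length (x ∷ xs) (y ∷ ys) len eq with ∷-injective eq
... | refl , eq′ with ++-cancel-equal-length xs ys (suc-injective len) eq′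
... | refl , us≡vs = refl , us≡vs

length-cartesianProductWith : ∀ {A B C : Set} (g : A → B → C) xs ys →
                              length (cartesianProductWith g xs ys) ≡ length xs * length ys
length-cartesianProductWith g []       ys = refl
length-cartesianProductWith g (x ∷ xs) ys = begin
  length (map (g x) ys ++ cartesianProductWith g xs ys)           ≡⟨ length-++ (map (g x) ys) ⟩
  length (map (g x) ys) + length (cartesianProductWith g xs ys)   ≡⟨ cong₂ _+_ (length-map (g x) ys) (length-cartesianProductWith g xs ys) ⟩
  length ys + length xs * length ys                               ∎
  where open ≡-Reasoning

PrefixCode : (Bool → List ℕ) → Set
PrefixCode c = ∀ {b b′ X Y} → c b ++ X ≡ c b′ ++ Y → b ≡ b′ × X ≡ Y

-- The state reached from (0 , 1) after either end block.
ρ : State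
ρ = 1 , 2

-- The two end blocks "1 1" and "2"; both have continuant 2 and predecessor 1.
edge : Bool → List ℕ
edge true  = 1 ∷ 1 ∷ []
edge false = 2 ∷ []

run-edge : ∀ e → run (0 , 1) (edge e) ≡ ρ
run-edge true  = refl
run-edge false = refl

close-edge : ∀ r e → proj₂ (run r (edge e)) ≡ r · ρ
close-edge (x , y) true  = lemma x y
  where
  lemma : ∀ x y → 1 * (1 * y + x) + y ≡ x * 1 + y * 2
  lemma = solve-∀
close-edge (x , y) false = lemma x y
  where
  lemma : ∀ x y → 2 * y + x ≡ x * 1 + y * 2
  lemma = solve-∀

-- The value common to all four framings of M.
framedValue : List ℕ → ℕ
framedValue M = run ρ M · ρ

frame : Bool × Bool → List ℕ → List ℕ
frame (e₁ , e₂) M = edge e₁ ++ M ++ edge e₂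

continuant-frame : ∀ e M → continuant (frame e M) ≡ framedValue M
continuant-frame (e₁ , e₂) M = begin
  continuant (edge e₁ ++ M ++ edge e₂)                  ≡⟨ continuantAux-run 0 1 (edge e₁ ++ M ++ edge e₂) ⟩
  proj₂ (run (0 , 1) (edge e₁ ++ M ++ edge e₂))         ≡⟨ cong proj₂ (foldl-++ step (0 , 1) (edge e₁) (M ++ edge e₂)) ⟩
  proj₂ (run (run (0 , 1) (edge e₁)) (M ++ edge e₂))    ≡⟨ cong (λ s → proj₂ (run s (M ++ edge e₂))) (run-edge e₁) ⟩
  proj₂ (run ρ (M ++ edge e₂))                          ≡⟨ cong proj₂ (foldl-++ step ρ M (edge e₂)) ⟩
  proj₂ (run (run ρ M) (edge e₂))                       ≡⟨ close-edge (run ρ M) e₂ ⟩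
  framedValue M                                         ∎
  where open ≡-Reasoning

hinge : Bool → List ℕ
hinge true  = 1 ∷ 1 ∷ 1 ∷ 2 ∷ []
hinge false = 2 ∷ 1 ∷ 1 ∷ 1 ∷ []

hinge-identity : ∀ b r → r · run r (hinge b) ≡ 2 * (r · ρ) * (r · ρ)
hinge-identity true  (x , y) = lemma x y
  where
  lemma : ∀ x y → x * (1 * (1 * (1 * y + x) + y) + (1 * y + x)) + y * (2 * (1 * (1 * (1 * y + x) + y) + (1 * y + x)) + (1 * (1 * y + x) + y))
                  ≡ 2 * (x * 1 + y * 2) * (x * 1 + y * 2)
  lemma = solve-∀
hinge-identity false (x , y) = lemma x y
  where
  lemma : ∀ x y → x * (1 * (1 * (2 * y + x) + y) + (2 * y + x)) + y * (1 * (1 * (1 * (2 * y + x) + y) + (2 * y + x)) + (1 * (2 * y + x) + y))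
                  ≡ 2 * (x * 1 + y * 2) * (x * 1 + y * 2)
  lemma = solve-∀

mirror : Bool → List ℕ → List ℕ
mirror b M = M ++ hinge b ++ reverse M

framedValue-mirror : ∀ b M → framedValue (mirror b M) ≡ 2 * framedValue M * framedValue M
framedValue-mirror b M = begin
  run ρ (M ++ hinge b ++ reverse M) · ρ    ≡⟨ cong (_· ρ) (foldl-++ step ρ M (hinge b ++ reverse M)) ⟩
  run r (hinge b ++ reverse M) · ρ         ≡⟨ cong (_· ρ) (foldl-++ step r (hinge b) (reverse M)) ⟩
  run (run r (hinge b)) (reverse M) · ρ    ≡⟨ run-reverse (run r (hinge b)) M ρ ⟩
  r · run r (hinge b)                      ≡⟨ hinge-identity b r ⟩
  2 * framedValue M * framedValue M        ∎
  where
  open ≡-Reasoning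
  r : State
  r = run ρ M

target : ℕ → ℕ
target k = 2 ^ (2 ^ k ∸ 1)

-- 2^(2^(k+1) - 1) = 2 · (2^(2^k - 1))², since 2^(k+1) - 1 = 1 + 2 (2^k - 1).
target-suc : ∀ k → target (suc k) ≡ 2 * target k * target k
target-suc k with 2 ^ k | m^n>0 2 k
... | zero  | ()
... | suc m | _ = begin
  2 ^ (m + suc (m + 0))  ≡⟨ cong (2 ^_) (trans (+-suc m (m + 0)) (cong (λ n → suc (m + n)) (+-identityʳ m))) ⟩
  2 * 2 ^ (m + m)        ≡⟨ cong (2 *_) (^-distribˡ-+-* 2 m m) ⟩
  2 * (2 ^ m * 2 ^ m)    ≡⟨ *-assoc 2 (2 ^ m) (2 ^ m) ⟨
  2 * 2 ^ m * 2 ^ m      ∎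
  where open ≡-Reasoning

bools : List Bool
bools = true ∷ false ∷ []

mirrors : ℕ → List (List ℕ)
mirrors zero    = [ [ 1 ] ]
mirrors (suc n) = cartesianProductWith mirror bools (mirrors n)

solutions : ℕ → List (List ℕ)
solutions n = cartesianProductWith frame (cartesianProduct bools bools) (mirrors n)

mirrors-value : ∀ n {M} → M ∈ mirrors n → framedValue M ≡ target (2 + n)
mirrors-value zero    (here refl) = refl
mirrors-value (suc n) M∈ with ∈-cartesianProductWith⁻ mirror bools (mirrors n) M∈
... | b , M , _ , M∈ₙ , refl = begin
  framedValue (mirror b M)               ≡⟨ framedValue-mirror b M ⟩
  2 * framedValue M * framedValue M      ≡⟨ cong (λ v → 2 * v * v) (mirrors-value n M∈ₙ) ⟩
  2 * target (2 + n) * target (2 + n)    ≡⟨ target-suc (2 + n) ⟨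
  target (3 + n)                         ∎
  where open ≡-Reasoning

edge-letters : ∀ e → All (Letter 3) (edge e)
edge-letters true  = here refl ∷ here refl ∷ []
edge-letters false = there (here refl) ∷ []

hinge-letters : ∀ b → All (Letter 3) (hinge b)
hinge-letters true  = here refl ∷ here refl ∷ here refl ∷ there (here refl) ∷ []
hinge-letters false = there (here refl) ∷ here refl ∷ here refl ∷ here refl ∷ []

mirrors-letters : ∀ n {M} → M ∈ mirrors n → All (Letter 3) M
mirrors-letters zero    (here refl) = here refl ∷ []
mirrors-letters (suc n) M∈ with ∈-cartesianProductWith⁻ mirror bools (mirrors n) M∈
... | b , M , _ , M∈ₙ , refl = ++⁺ ok (++⁺ (hinge-letters b) (all-reverse ok))
  where
  ok : All (Letter 3) M
  ok = mirrors-letters n M∈ₙ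

solutions-sound : ∀ n {w} → w ∈ solutions n → Solution 3 (target (2 + n)) w
solutions-sound n w∈ with ∈-cartesianProductWith⁻ frame (cartesianProduct bools bools) (mirrors n) w∈
... | (e₁ , e₂) , M , _ , M∈ , refl = record
  { nonempty = edge-nonempty e₁
  ; letters  = ++⁺ (edge-letters e₁) (++⁺ (mirrors-letters n M∈) (edge-letters e₂))
  ; value    = trans (continuant-frame (e₁ , e₂) M) (mirrors-value n M∈)
  }
  where
  edge-nonempty : ∀ e → 1 ≤ length (edge e ++ M ++ edge e₂)
  edge-nonempty true  = s≤s z≤n
  edge-nonempty false = s≤s z≤n

edge-prefix : PrefixCode edge
edge-prefix {true}  {true}  refl = refl , refl
edge-prefix {false} {false} refl = refl , refl
edge-prefix {true}  {false} ()
edge-prefix {false} {true}  ()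

hinge-prefix : PrefixCode hinge
hinge-prefix {true}  {true}  refl = refl , refl
hinge-prefix {false} {false} refl = refl , refl
hinge-prefix {true}  {false} ()
hinge-prefix {false} {true}  ()

edge-palindrome : ∀ e → reverse (edge e) ≡ edge e
edge-palindrome true  = refl
edge-palindrome false = refl

-- End blocks are also recognised at the end of a word, as they are palindromes.
edge-suffix : ∀ {e e′ M M′} → M ++ edge e ≡ M′ ++ edge e′ → e ≡ e′ × M ≡ M′
edge-suffix {e} {e′} {M} {M′} eq with edge-prefix reversed
  where
  open ≡-Reasoning
  reversed : edge e ++ reverse M ≡ edge e′ ++ reverse M′
  reversed = begin
    edge e ++ reverse M               ≡⟨ cong (_++ reverse M) (edge-palindrome e) ⟨
    reverse (edge e) ++ reverse M     ≡⟨ reverse-++ M (edge e) ⟨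
    reverse (M ++ edge e)             ≡⟨ cong reverse eq ⟩
    reverse (M′ ++ edge e′)           ≡⟨ reverse-++ M′ (edge e′) ⟩
    reverse (edge e′) ++ reverse M′   ≡⟨ cong (_++ reverse M′) (edge-palindrome e′) ⟩
    edge e′ ++ reverse M′             ∎
... | e≡e′ , revM≡revM′ = e≡e′ , reverse-injective revM≡revM′

frame-injective : ∀ {e e′ M M′} → frame e M ≡ frame e′ M′ → e ≡ e′ × M ≡ M′
frame-injective {e₁ , e₂} {e₁′ , e₂′} eq with edge-prefix {e₁} {e₁′} eq
... | refl , eq′ with edge-suffix {e₂} {e₂′} eq′
... | refl , M≡M′ = refl , M≡M′

-- The length of a mirror word determines the length of its half.
mirror-length : ∀ b M → length (mirror b M) ≡ 4 + 2 * length M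
mirror-length b M = begin
  length (M ++ hinge b ++ reverse M)                  ≡⟨ length-++ M ⟩
  length M + length (hinge b ++ reverse M)            ≡⟨ cong (length M +_) (length-++ (hinge b)) ⟩
  length M + (length (hinge b) + length (reverse M))  ≡⟨ cong₂ (λ h r → length M + (h + r)) (hinge-length b) (length-reverse M) ⟩
  length M + (4 + length M)                           ≡⟨ rearrange (length M) ⟩
  4 + 2 * length M                                    ∎
  where
  open ≡-Reasoning
  hinge-length : ∀ b → length (hinge b) ≡ 4
  hinge-length true  = refl
  hinge-length false = refl
  rearrange : ∀ m → m + (4 + m) ≡ 4 + 2 * m
  rearrange = solve-∀

-- Equal mirror words have equal halves (by length) and equal hinges.
mirror-injective : ∀ {b b′ M M′} → mirror b M ≡ mirror b′ M′ → b ≡ b′ × M ≡ M′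
mirror-injective {b} {b′} {M} {M′} eq
  with ++-cancel-equal-length M M′ same-length eq
  where
  same-length : length M ≡ length M′
  same-length = *-cancelˡ-≡ (length M) (length M′) 2
    (+-cancelˡ-≡ 4 _ _ (trans (sym (mirror-length b M)) (trans (cong length eq) (mirror-length b′ M′))))
... | refl , hinges≡ = proj₁ (hinge-prefix hinges≡) , refl

bools-unique : Unique bools
bools-unique = ((λ ()) ∷ []) ∷ [] ∷ []

mirrors-unique : ∀ n → Unique (mirrors n)
mirrors-unique zero    = [] ∷ []
mirrors-unique (suc n) = cartesianProductWith⁺ mirror mirror-injective bools-unique (mirrors-unique n)

solutions-unique : ∀ n → Unique (solutions n)
solutions-unique n =
  cartesianProductWith⁺ frame frame-injective (cartesianProduct⁺ bools-unique bools-unique) (mirrors-unique n)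

mirrors-length : ∀ n → length (mirrors n) ≡ 2 ^ n
mirrors-length zero    = refl
mirrors-length (suc n) = trans (length-cartesianProductWith mirror bools (mirrors n)) (cong (2 *_) (mirrors-length n))

solutions-length : ∀ n → length (solutions n) ≡ 2 ^ (2 + n)
solutions-length n = begin
  length (solutions n)  ≡⟨ length-cartesianProductWith frame (cartesianProduct bools bools) (mirrors n) ⟩
  4 * length (mirrors n) ≡⟨ cong (4 *_) (mirrors-length n) ⟩
  4 * 2 ^ n              ≡⟨ *-assoc 2 2 (2 ^ n) ⟩
  2 ^ (2 + n)            ∎
  where open ≡-Reasoning

theorem5 : ∀ (k : ℕ) → 2 ≤ k → 2 ^ k ≤ f (2 ^ (2 ^ k ∸ 1)) 3
theorem5 (suc (suc n)) (s≤s (s≤s z≤n)) = begin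
  2 ^ (2 + n)           ≡⟨ solutions-length n ⟨
  length (solutions n)  ≤⟨ f-lower-bound (solutions n) (solutions-unique n) (solutions-sound n) ⟩
  f (target (2 + n)) 3  ∎
  where open ≤-Reasoning
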